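{- Let $m\geq 8$ be even and let $n$ be a positive integer with $n\equiv 3 \pmod{m/2}$. Then $R(S_n(1,2),W_m)\geq 2n+m/2-3$.
   Context: All graphs are finite, simple, undirected. For graphs $G,H$, the Ramsey number $R(G,H)$ is the smallest positive integer $N$ such that for every graph $F$ on $N$ vertices, either $F$ contains a subgraph isomorphic to $G$ or the complement $\overline{F}$ contains a subgraph isomorphic to $H$. $W_m$ is the wheel on $m+1$ vertices: a cycle $C_m$ plus one extra vertex adjacent to all vertices of the cycle. $S_n(1,2)$ denotes the tree of order $n$ obtained from the star $S_{n-2}$ (star on $n-2$ vertices) by subdividing one edge twice. -}

module Defs where

open import Data.Nat using (ℕ; zero; suc; _+_; _*_; _%_; _≤_; _<_)
open import Data.Fin using (Fin; toℕ) renaming (zero to fz; suc to fs)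
open import Data.Product using (Σ; _×_; _,_)
open import Data.Sum using (_⊎_; inj₁; inj₂)
open import Relation.Nullary using (¬_)
open import Relation.Binary.PropositionalEquality as Eq using (_≡_; _≢_)
open import Function.Definitions using (Injective)

record Graph : Set₁ where
  field
    order  : ℕ
    adj    : Fin order → Fin order → Set
    sym    : ∀ {u v} → adj u v → adj v u
    irrefl : ∀ {u} → ¬ adj u u
open Graph public

mkGraph : (n : ℕ) → (Fin n → Fin n → Set) → Graph
mkGraph n R = record
  { order  = n
  ; adj    = λ u v → (u ≢ v) × (R u v ⊎ R v u)
  ; sym    = λ { (ne , inj₁ r) → (λ e → ne (Eq.sym e)) , inj₂ r
               ; (ne , inj₂ r) → (λ e → ne (Eq.sym e)) , inj₁ r }
  ; irrefl = λ { (ne , _) → ne Eq.refl }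
  }

complement : Graph → Graph
complement G = record
  { order  = order G
  ; adj    = λ u v → (u ≢ v) × ¬ adj G u v
  ; sym    = λ { (ne , na) → (λ e → ne (Eq.sym e)) , (λ a → na (Graph.sym G a)) }
  ; irrefl = λ { (ne , _) → ne Eq.refl }
  }

_⊆_ : Graph → Graph → Set
G ⊆ F = Σ (Fin (order G) → Fin (order F)) λ f →
          Injective _≡_ _≡_ f × (∀ u v → adj G u v → adj F (f u) (f v))

RamseyProp : Graph → Graph → ℕ → Set₁
RamseyProp G H N = (F : Graph) → order F ≡ N → (G ⊆ F) ⊎ (H ⊆ complement F)

-- "R(G,H) ≥ k": R(G,H) is the smallest positive N with the Ramsey property,
-- so R(G,H) ≥ k means every positive N with the Ramsey property has k ≤ N.
RamseyAtLeast : Graph → Graph → ℕ → Set₁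
RamseyAtLeast G H k = ∀ N → 1 ≤ N → RamseyProp G H N → k ≤ N

-- Wheel W_m on m+1 vertices (vertex set Fin (suc m)): fz is the hub,
-- adjacent to every fs i (i : Fin m); the fs i form the cycle C_m with
-- i — i+1 (mod m), i.e. toℕ j = toℕ i + 1, or (toℕ i + 1 = m and toℕ j = 0).
data WheelRel (m : ℕ) : Fin (suc m) → Fin (suc m) → Set where
  spoke : ∀ i → WheelRel m fz (fs i)
  rim   : ∀ i j → toℕ j ≡ suc (toℕ i) → WheelRel m (fs i) (fs j)
  wrap  : ∀ i j → suc (toℕ i) ≡ m → toℕ j ≡ 0 → WheelRel m (fs i) (fs j)

W : ℕ → Graph
W m = mkGraph (suc m) (WheelRel m)

-- S_n(1,2) on vertex set Fin n: start from the star S_{n-2} with centre 0 and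
-- leaves 3,4,...,n-1, and subdivide the edge 0—3 twice by new vertices 1,2.
-- Edges: 0—1, 1—2, 2—3, and 0—k for every 4 ≤ k < n.
data SRel (n : ℕ) : Fin n → Fin n → Set where
  e01  : ∀ u v → toℕ u ≡ 0 → toℕ v ≡ 1 → SRel n u v
  e12  : ∀ u v → toℕ u ≡ 1 → toℕ v ≡ 2 → SRel n u v
  e23  : ∀ u v → toℕ u ≡ 2 → toℕ v ≡ 3 → SRel n u v
  leaf : ∀ u v → toℕ u ≡ 0 → 4 ≤ toℕ v → SRel n u v

S[1,2] : ℕ → Graph
S[1,2] n = mkGraph n (SRel n)

-- Let n = 3 + qk and let F be a clique K_{n-1} beside the complete (q+1)-partite graph
-- with parts of size k, so F has 2n + k - 4 vertices. A copy of S_n(1,2) in F is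
-- connected, so it lies in one component. The clique has only n - 1 vertices. In the
-- multipartite graph, the centre's neighbours and one of the two adjacent vertices 2, 3
-- avoid the centre's part: n - 2 vertices, but only qk = n - 3 lie outside a part.
-- The complement of F joins the clique completely to disjoint copies of K_k, one per
-- part. A wheel W_{2k} there with its hub in the clique has its whole rim cycle in one
-- K_k; with its hub in a K_k, every rim vertex is in that K_k or in the independent
-- clique side, so each of the k disjoint rim edges meets the K_k. Either way a K_k would
-- contain more than k vertices.
module Submission where

open import Defs
open import Data.Nat using (ℕ; _+_; _*_; _∸_; _≤_)
open import Data.Product using (∃)
open import Relation.Binary.PropositionalEquality using (_≡_)

open import Data.Empty using (⊥; ⊥-elim)
open import Data.Fin using (Fin; suc; toℕ; inject₁; inject≤; cast; combine; punchIn; punchOut; _≟_)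
open import Data.Fin.Induction using (<-weakInduction)
open import Data.Fin.Patterns using (0F; 1F; 2F; 3F)
open import Data.Fin.Properties
  using (+↔⊎; *↔×; injective⇒≤; suc-injective; toℕ-injective; toℕ-inject₁; toℕ-cast; toℕ-combine;
         combine-injective; combine-injectiveˡ; punchIn-injective; punchOut-injective; inject≤-injective)
open import Data.Nat using (suc; z≤n; s≤s)
open import Data.Nat.Properties
  using (≤-refl; ≤-reflexive; ≤-trans; ≮⇒≥; _<?_; 1+n≢n; 1+n≰n; m+1+n≰m; *-comm; +-suc)
open import Data.Nat.Tactic.RingSolver using (solve-∀)
open import Data.Product using (Σ; _×_; _,_; proj₁; proj₂)
open import Data.Sum using (_⊎_; inj₁; inj₂; [_,_]′)
open import Data.Sum.Function.Propositional using (_⊎-↔_)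
open import Data.Unit using (⊤; tt)
open import Function using (_∘_; id; _↔_; Inverse; Injection)
open import Function.Definitions using (Injective)
open import Function.Properties.Inverse using (↔-refl; ↔-trans; Inverse⇒Injection)
open import Relation.Binary.Definitions using (Symmetric)
open import Relation.Nullary using (¬_; yes; no)
open import Relation.Binary.PropositionalEquality
  using (_≢_; refl; trans; cong; module ≡-Reasoning) renaming (sym to ≡-sym)

AtLeast : ∀ {X : Set} → ℕ → (X → Set) → Set
AtLeast {X} c P = Σ (Fin c → X) λ g → Injective _≡_ _≡_ g × (∀ i → P (g i))

AtMost : ∀ {X : Set} → ℕ → (X → Set) → Set
AtMost {X} b P = Σ (∀ x → P x → Fin b) λ code → ∀ {x y} px py → code x px ≡ code y py → x ≡ y

atLeast≤atMost : ∀ {X : Set} {P : X → Set} {b c} → AtLeast c P → AtMost b P → c ≤ b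
atLeast≤atMost (g , g-inj , Pg) (code , code-inj) = injective⇒≤ (g-inj ∘ code-inj (Pg _) (Pg _))

atLeast-map : ∀ {X Y : Set} {P : Y → Set} {f : X → Y} {c} →
              Injective _≡_ _≡_ f → AtLeast c (P ∘ f) → AtLeast c P
atLeast-map f-inj (g , g-inj , Pfg) = _ , g-inj ∘ f-inj , Pfg

Embedding : ∀ {X : Set} → Graph → (X → X → Set) → Set
Embedding {X} G R =
  Σ (Fin (order G) → X) λ f → Injective _≡_ _≡_ f × (∀ u v → adj G u v → R (f u) (f v))

induced : ∀ {X : Set} (N : ℕ) → (Fin N → X) → (X → X → Set) → Graph
induced N e R = mkGraph N (λ u v → R (e u) (e v))

module _ {X : Set} (R : X → X → Set) {N : ℕ} {e : Fin N → X} (e-inj : Injective _≡_ _≡_ e)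
         (G : Graph) where

  ⊆-induced⇒embedding : Symmetric R → G ⊆ induced N e R → Embedding G R
  ⊆-induced⇒embedding R-sym (f , f-inj , f-adj) =
    e ∘ f , f-inj ∘ e-inj , λ u v uv → [ id , R-sym ]′ (proj₂ (f-adj u v uv))

  ⊆-complement⇒embedding : G ⊆ complement (induced N e R) → Embedding G (λ x y → ¬ R x y)
  ⊆-complement⇒embedding (f , f-inj , f-adj) =
    e ∘ f , f-inj ∘ e-inj , λ u v uv r → proj₂ (f-adj u v uv) (proj₁ (f-adj u v uv) , inj₁ r)

ramseyAtLeast-from-relation : ∀ {X : Set} {M} {e : Fin M → X} (G H : Graph) (R : X → X → Set) →
  Injective _≡_ _≡_ e → Symmetric R → ¬ Embedding G R → ¬ Embedding H (λ x y → ¬ R x y) →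
  RamseyAtLeast G H (suc M)
ramseyAtLeast-from-relation {M = M} {e} G H R e-inj R-sym G-free H-free N _ ramsey with M <? N
... | yes M<N = M<N
... | no M≮N = ⊥-elim (neither (ramsey (induced N e′ R) refl))
  where
  e′ : Fin N → _
  e′ i = e (inject≤ i (≮⇒≥ M≮N))
  e′-inj : Injective _≡_ _≡_ e′
  e′-inj = inject≤-injective _ _ _ _ ∘ e-inj
  neither : G ⊆ induced N e′ R ⊎ H ⊆ complement (induced N e′ R) → ⊥
  neither (inj₁ G⊆F) = G-free (⊆-induced⇒embedding R e′-inj G R-sym G⊆F)
  neither (inj₂ H⊆F̄) = H-free (⊆-complement⇒embedding R e′-inj H H⊆F̄)

-- The graph K_a ∪ K_{(q+1)×k}: a vertex is a clique vertex or a (part, position) pair.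
V : ℕ → ℕ → ℕ → Set
V a q k = Fin a ⊎ (Fin (suc q) × Fin k)

Edge : ∀ {a q k} → V a q k → V a q k → Set
Edge (inj₁ _)       (inj₁ _)        = ⊤
Edge (inj₂ (p , _)) (inj₂ (p′ , _)) = p ≢ p′
Edge _              _               = ⊥

Edge-sym : ∀ {a q k} → Symmetric (Edge {a} {q} {k})
Edge-sym {x = inj₁ _} {inj₁ _} _    = tt
Edge-sym {x = inj₂ _} {inj₂ _} p≢p′ = p≢p′ ∘ ≡-sym

Fin↔V : ∀ {a q k} → Fin (a + suc q * k) ↔ V a q k
Fin↔V = ↔-trans +↔⊎ (↔-refl ⊎-↔ *↔×)

toV : ∀ {a q k} → Fin (a + suc q * k) → V a q k
toV = Inverse.to Fin↔V

toV-injective : ∀ {a q k} → Injective _≡_ _≡_ (toV {a} {q} {k})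
toV-injective = Injection.injective (Inverse⇒Injection Fin↔V)

InClique : ∀ {a q k} → V a q k → Set
InClique (inj₁ _) = ⊤
InClique (inj₂ _) = ⊥

InPart : ∀ {a q k} → Fin (suc q) → V a q k → Set
InPart p (inj₁ _)        = ⊥
InPart p (inj₂ (p′ , _)) = p′ ≡ p

InOtherPart : ∀ {a q k} → Fin (suc q) → V a q k → Set
InOtherPart p (inj₁ _)        = ⊥
InOtherPart p (inj₂ (p′ , _)) = p ≢ p′

InClique⊎InPart : ∀ {a q k} (x : V a q k) → InClique x ⊎ ∃ λ p → InPart p x
InClique⊎InPart (inj₁ _)       = inj₁ tt
InClique⊎InPart (inj₂ (p , _)) = inj₂ (p , refl)

InClique-closed : ∀ {a q k} {x y : V a q k} → Edge x y → InClique x → InClique y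
InClique-closed {x = inj₁ _} {inj₁ _} _ _ = tt

¬InClique-closed : ∀ {a q k} {x y : V a q k} → Edge x y → ¬ InClique x → ¬ InClique y
¬InClique-closed xy x∉K = x∉K ∘ InClique-closed (Edge-sym xy)

InClique⇒Edge : ∀ {a q k} {x y : V a q k} → InClique x → InClique y → Edge x y
InClique⇒Edge {x = inj₁ _} {inj₁ _} _ _ = tt

InOtherPart⇒¬InClique : ∀ {a q k} {x : V a q k} p → InOtherPart p x → ¬ InClique x
InOtherPart⇒¬InClique {x = inj₂ _} _ _ ()

¬InClique⇒InPart : ∀ {a q k} {x : V a q k} → ¬ InClique x → ∃ λ p → InPart p x
¬InClique⇒InPart {x = inj₁ _}       x∉K = ⊥-elim (x∉K tt)
¬InClique⇒InPart {x = inj₂ (p , _)} _   = p , refl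

InPart⇒Edge-InOtherPart : ∀ {a q k} {x y : V a q k} {p} → InPart p x → Edge x y → InOtherPart p y
InPart⇒Edge-InOtherPart {x = inj₂ _} {inj₂ _} refl p≢p′ = p≢p′

Edge-leaves-part : ∀ {a q k} {x y : V a q k} p → ¬ InClique x → ¬ InClique y → Edge x y →
                   InOtherPart p x ⊎ InOtherPart p y
Edge-leaves-part {x = inj₁ _} p x∉K _ _ = ⊥-elim (x∉K tt)
Edge-leaves-part {x = inj₂ _} {inj₁ _} p _ y∉K _ = ⊥-elim (y∉K tt)
Edge-leaves-part {x = inj₂ (p′ , _)} {inj₂ _} p _ _ p′≢p″ with p ≟ p′
... | no p≢p′  = inj₁ p≢p′
... | yes refl = inj₂ p′≢p″

InPart⇒¬Edge-InClique⊎InPart : ∀ {a q k} {x y : V a q k} {p} → InPart p x → ¬ Edge x y →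
                               InClique y ⊎ InPart p y
InPart⇒¬Edge-InClique⊎InPart {y = inj₁ _} _ _ = inj₁ tt
InPart⇒¬Edge-InClique⊎InPart {x = inj₂ _} {inj₂ (p′ , _)} {p} refl ¬xy with p′ ≟ p
... | yes p′≡p = inj₂ p′≡p
... | no p′≢p  = ⊥-elim (¬xy (p′≢p ∘ ≡-sym))

InPart⇒¬Edge-InPart : ∀ {a q k} {x y : V a q k} {p} → InPart p x → ¬ InClique y → ¬ Edge x y →
                      InPart p y
InPart⇒¬Edge-InPart x∈p y∉K ¬xy =
  [ ⊥-elim ∘ y∉K , id ]′ (InPart⇒¬Edge-InClique⊎InPart x∈p ¬xy)

atMost-InClique : ∀ {a q k} → AtMost a (λ (x : V a q k) → InClique x)
atMost-InClique {a} {q} {k} = code , code-inj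
  where
  code : (x : V a q k) → InClique x → Fin a
  code (inj₁ i) _ = i
  code-inj : ∀ {x y} px py → code x px ≡ code y py → x ≡ y
  code-inj {inj₁ _} {inj₁ _} _ _ = cong inj₁

atMost-InPart : ∀ {a q k} p → AtMost k (λ (x : V a q k) → InPart p x)
atMost-InPart {a} {q} {k} p = code , code-inj
  where
  code : (x : V a q k) → InPart p x → Fin k
  code (inj₂ (_ , i)) _ = i
  code-inj : ∀ {x y} px py → code x px ≡ code y py → x ≡ y
  code-inj {inj₂ _} {inj₂ _} refl refl = cong (inj₂ ∘ (p ,_))

atMost-InOtherPart : ∀ {a q k} p → AtMost (q * k) (λ (x : V a q k) → InOtherPart p x)
atMost-InOtherPart {a} {q} {k} p = code , code-inj
  where
  code : (x : V a q k) → InOtherPart p x → Fin (q * k)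
  code (inj₂ (_ , i)) p≢p′ = combine (punchOut p≢p′) i
  code-inj : ∀ {x y} px py → code x px ≡ code y py → x ≡ y
  code-inj {inj₂ (_ , i)} {inj₂ (_ , j)} p≢p′ p≢p″ eq
    with combine-injective (punchOut p≢p′) i (punchOut p≢p″) j eq
  ... | eq′ , refl with punchOut-injective p≢p′ p≢p″ eq′
  ...   | refl = refl

S-leaf : ∀ {r} → Fin r → Fin (4 + r)
S-leaf i = suc (suc (suc (suc i)))

S-edge-0-1 : ∀ {r} → adj (S[1,2] (4 + r)) 0F 1F
S-edge-0-1 = (λ ()) , inj₁ (e01 _ _ refl refl)

S-edge-1-2 : ∀ {r} → adj (S[1,2] (4 + r)) 1F 2F
S-edge-1-2 = (λ ()) , inj₁ (e12 _ _ refl refl)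

S-edge-2-3 : ∀ {r} → adj (S[1,2] (4 + r)) 2F 3F
S-edge-2-3 = (λ ()) , inj₁ (e23 _ _ refl refl)

S-edge-0-leaf : ∀ {r} (i : Fin r) → adj (S[1,2] (4 + r)) 0F (S-leaf i)
S-edge-0-leaf i = (λ ()) , inj₁ (leaf _ _ refl (s≤s (s≤s (s≤s (s≤s z≤n)))))

S[1,2]-connected : ∀ {r} (P : Fin (4 + r) → Set) →
                   (∀ {u v} → adj (S[1,2] (4 + r)) u v → P u → P v) → P 0F → ∀ v → P v
S[1,2]-connected P closed P₀ 0F                    = P₀
S[1,2]-connected P closed P₀ 1F                    = closed S-edge-0-1 P₀
S[1,2]-connected P closed P₀ 2F                    = closed S-edge-1-2 (closed S-edge-0-1 P₀)
S[1,2]-connected P closed P₀ 3F                    =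
  closed S-edge-2-3 (closed S-edge-1-2 (closed S-edge-0-1 P₀))
S[1,2]-connected P closed P₀ (suc (suc (suc (suc i)))) = closed (S-edge-0-leaf i) P₀

-- The witnesses are all vertices but the centre and the one of 2, 3 not known to satisfy P.
atLeast-S[1,2]-noncentral : ∀ {r} (P : Fin (4 + r) → Set) →
                            P 1F → (∀ i → P (S-leaf i)) → P 2F ⊎ P 3F → AtLeast (2 + r) P
atLeast-S[1,2]-noncentral P P₁ P-leaf (inj₁ P₂) =
  suc ∘ punchIn 2F , punchIn-injective 2F _ _ ∘ suc-injective ,
  λ { 0F → P₁ ; 1F → P₂ ; (suc (suc i)) → P-leaf i }
atLeast-S[1,2]-noncentral P P₁ P-leaf (inj₂ P₃) =
  suc ∘ punchIn 1F , punchIn-injective 1F _ _ ∘ suc-injective ,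
  λ { 0F → P₁ ; 1F → P₃ ; (suc (suc i)) → P-leaf i }

S[1,2]-free : ∀ {a q k r} → a ≤ 3 + r → q * k ≤ suc r →
              ¬ Embedding (S[1,2] (4 + r)) (Edge {a} {q} {k})
S[1,2]-free a≤ qk≤ (f , f-inj , f-edge) with InClique⊎InPart (f 0F)
... | inj₁ centre∈K =
  1+n≰n (≤-trans (atLeast≤atMost (f , f-inj , all∈K) atMost-InClique) a≤)
  where
  all∈K = S[1,2]-connected (InClique ∘ f) (λ uv → InClique-closed (f-edge _ _ uv)) centre∈K
... | inj₂ (p , centre∈p) =
  1+n≰n (≤-trans (atLeast≤atMost (atLeast-map {P = InOtherPart p} f-inj noncentral)
                                 (atMost-InOtherPart p)) qk≤)
  where
  off-centre : ∀ {v} → adj (S[1,2] _) 0F v → InOtherPart p (f v)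
  off-centre uv = InPart⇒Edge-InOtherPart centre∈p (f-edge _ _ uv)
  1∉K = InOtherPart⇒¬InClique p (off-centre S-edge-0-1)
  2∉K = ¬InClique-closed (f-edge _ _ S-edge-1-2) 1∉K
  3∉K = ¬InClique-closed (f-edge _ _ S-edge-2-3) 2∉K
  noncentral = atLeast-S[1,2]-noncentral (InOtherPart p ∘ f)
    (off-centre S-edge-0-1) (off-centre ∘ S-edge-0-leaf)
    (Edge-leaves-part p 2∉K 3∉K (f-edge _ _ S-edge-2-3))

W-spoke : ∀ {m} (i : Fin m) → adj (W m) 0F (suc i)
W-spoke i = (λ ()) , inj₁ (spoke i)

W-rim : ∀ {m} (i j : Fin m) → toℕ j ≡ suc (toℕ i) → adj (W m) (suc i) (suc j)
W-rim i j j≡1+i =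
  (λ i≡j → 1+n≢n (trans (≡-sym j≡1+i) (cong toℕ (≡-sym (suc-injective i≡j))))) ,
  inj₁ (rim i j j≡1+i)

W-rim-step : ∀ {m} (i : Fin m) → adj (W (suc m)) (suc (inject₁ i)) (suc (suc i))
W-rim-step i = W-rim (inject₁ i) (suc i) (cong suc (≡-sym (toℕ-inject₁ i)))

rimPair : ∀ {k} → Fin k → Fin 2 → Fin (2 * k)
rimPair {k} i b = cast (*-comm k 2) (combine i b)

W-rimPair : ∀ {k} (i : Fin k) → adj (W (2 * k)) (suc (rimPair i 0F)) (suc (rimPair i 1F))
W-rimPair i = W-rim _ _ (begin
  toℕ (rimPair i 1F)          ≡⟨ toℕ-cast _ (combine i 1F) ⟩
  toℕ (combine i 1F)          ≡⟨ toℕ-combine i 1F ⟩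
  2 * toℕ i + 1               ≡⟨ +-suc (2 * toℕ i) 0 ⟩
  suc (2 * toℕ i + 0)         ≡⟨ cong suc (toℕ-combine i 0F) ⟨
  suc (toℕ (combine i 0F))    ≡⟨ cong suc (toℕ-cast _ (combine i 0F)) ⟨
  suc (toℕ (rimPair i 0F))    ∎)
  where open ≡-Reasoning

rimPair-injectiveˡ : ∀ {k} (i j : Fin k) b b′ → rimPair i b ≡ rimPair j b′ → i ≡ j
rimPair-injectiveˡ i j b b′ eq = combine-injectiveˡ i b j b′ (toℕ-injective (begin
  toℕ (combine i b)    ≡⟨ toℕ-cast _ (combine i b) ⟨
  toℕ (rimPair i b)    ≡⟨ cong toℕ eq ⟩
  toℕ (rimPair j b′)   ≡⟨ toℕ-cast _ (combine j b′) ⟩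
  toℕ (combine j b′)   ∎))
  where open ≡-Reasoning

hub∉InClique : ∀ {a q k}
               ((w , _) : Embedding (W (2 * suc k)) (λ x y → ¬ Edge {a} {q} {suc k} x y)) →
               ¬ InClique (w 0F)
hub∉InClique {k = k} (w , w-inj , w-edge) hub∈K =
  m+1+n≰m (suc k) (atLeast≤atMost (w ∘ suc , suc-injective ∘ w-inj , all∈p) (atMost-InPart p))
  where
  rim∉K : ∀ i → ¬ InClique (w (suc i))
  rim∉K i rim∈K = w-edge _ _ (W-spoke i) (InClique⇒Edge hub∈K rim∈K)
  p = proj₁ (¬InClique⇒InPart (rim∉K 0F))
  all∈p = <-weakInduction (λ i → InPart p (w (suc i))) (proj₂ (¬InClique⇒InPart (rim∉K 0F)))
    (λ i ∈p → InPart⇒¬Edge-InPart ∈p (rim∉K (suc i)) (w-edge _ _ (W-rim-step i)))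

hub∉InPart : ∀ {a q k} ((w , _) : Embedding (W (2 * k)) (λ x y → ¬ Edge {a} {q} {k} x y)) p →
             ¬ InPart p (w 0F)
hub∉InPart {k = k} (w , w-inj , w-edge) p hub∈p =
  1+n≰n (atLeast≤atMost (g , g-inj , g∈p) (atMost-InPart p))
  where
  rim∈K⊎p : ∀ i → InClique (w (suc i)) ⊎ InPart p (w (suc i))
  rim∈K⊎p i = InPart⇒¬Edge-InClique⊎InPart hub∈p (w-edge _ _ (W-spoke i))
  choice : ∀ i → ∃ λ b → InPart p (w (suc (rimPair i b)))
  choice i with rim∈K⊎p (rimPair i 0F) | rim∈K⊎p (rimPair i 1F)
  ... | inj₂ ∈p | _      = 0F , ∈p
  ... | inj₁ _  | inj₂ ∈p = 1F , ∈p
  ... | inj₁ ∈K | inj₁ ∈K′ = ⊥-elim (w-edge _ _ (W-rimPair i) (InClique⇒Edge ∈K ∈K′))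
  g : Fin (suc k) → _
  g 0F      = w 0F
  g (suc i) = w (suc (rimPair i (proj₁ (choice i))))
  g∈p : ∀ i → InPart p (g i)
  g∈p 0F      = hub∈p
  g∈p (suc i) = proj₂ (choice i)
  g-inj : Injective _≡_ _≡_ g
  g-inj {0F}    {0F}    _  = refl
  g-inj {0F}    {suc _} eq with () ← w-inj eq
  g-inj {suc _} {0F}    eq with () ← w-inj eq
  g-inj {suc i} {suc j} eq = cong suc (rimPair-injectiveˡ i j _ _ (suc-injective (w-inj eq)))

W-free : ∀ {a q k} → 1 ≤ k → ¬ Embedding (W (2 * k)) (λ x y → ¬ Edge {a} {q} {k} x y)
W-free {k = suc _} _ ι with InClique⊎InPart (proj₁ ι 0F)
... | inj₁ hub∈K       = hub∉InClique ι hub∈K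
... | inj₂ (p , hub∈p) = hub∉InPart ι p hub∈p

ramseyAtLeast-S[1,2]-W : ∀ {q k r} → 1 ≤ k → q * k ≤ suc r →
  RamseyAtLeast (S[1,2] (4 + r)) (W (2 * k)) (suc (3 + r + suc q * k))
ramseyAtLeast-S[1,2]-W {q} {k} {r} 1≤k qk≤ =
  ramseyAtLeast-from-relation (S[1,2] (4 + r)) (W (2 * k)) (Edge {3 + r} {q} {k})
    toV-injective Edge-sym (S[1,2]-free ≤-refl qk≤) (W-free 1≤k)

1≤half : ∀ {k} → 1 ≤ 2 * k → 1 ≤ k
1≤half {suc _} _ = s≤s z≤n

-- The left-hand side is what 2 * (4 + r) + k ∸ 3 reduces to, minus its leading suc.
lower-bound-arithmetic : ∀ r k → r + (4 + (r + 0)) + k ≡ 3 + (r + (k + suc r))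
lower-bound-arithmetic = solve-∀

corollary1 : ∀ (m k n : ℕ) → m ≡ 2 * k → 8 ≤ m → 4 ≤ n
             → ∃ (λ q → n ≡ 3 + q * k)
             → RamseyAtLeast (S[1,2] n) (W m) (2 * n + k ∸ 3)
corollary1 _ k _ refl 8≤2k (s≤s (s≤s (s≤s (s≤s (z≤n {r}))))) (q , 4+r≡3+qk) N 1≤N ramsey =
  ≤-trans (≤-reflexive bound≡)
    (ramseyAtLeast-S[1,2]-W {q} (1≤half (≤-trans (s≤s z≤n) 8≤2k)) (≤-reflexive qk≡1+r) N 1≤N ramsey)
  where
  qk≡1+r : q * k ≡ suc r
  qk≡1+r = ≡-sym (cong (_∸ 3) 4+r≡3+qk)
  bound≡ : 2 * (4 + r) + k ∸ 3 ≡ suc (3 + r + suc q * k)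
  bound≡ = cong suc (trans (lower-bound-arithmetic r k) (cong (λ x → 3 + (r + (k + x))) (≡-sym qk≡1+r)))
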